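{- Let $p$ be a prime, let $A\subseteq\mathbb{Z}_p^2$ be a $g$-Sidon set with $|A|=m$, and let $q=p^2s$ with $s$ a positive integer. Then there is a $g(s+1)$-Sidon set $A'\subseteq\mathbb{Z}_q$ with $|A'|=ms$.
   Context: For a subset $A$ of a commutative group, the representation function is $r(x)=\#\{(a_1,a_2): a_1,a_2\in A,\ a_1+a_2=x\}$ (ordered pairs). $A$ is a $g$-Sidon set if $r(x)\le g$ for all $x$. Here $\mathbb{Z}_n=\mathbb{Z}/n\mathbb{Z}$. -}

module Defs where

open import Data.Nat using (ℕ; zero; suc; _+_; _*_; _≤_; NonZero)
open import Data.Nat.DivMod using (_mod_)
open import Data.Fin using (Fin; toℕ)
open import Data.Fin.Subset using (Subset; _∈_; ∣_∣)
open import Data.Fin.Subset.Properties using (_∈?_)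
open import Data.Product using (_×_; _,_)
open import Data.List using (List; length; filter; cartesianProduct; allFin)
open import Relation.Nullary using (Dec; yes; no)
open import Relation.Nullary.Decidable using (_×-dec_)
open import Data.Fin.Properties using (_≟_)
open import Data.Product.Properties using (≡-dec)
open import Relation.Binary.PropositionalEquality using (_≡_)

_+ₙ_ : ∀ {n} .{{_ : NonZero n}} → Fin n → Fin n → Fin n
_+ₙ_ {n} a b = (toℕ a + toℕ b) mod n

_+²_ : ∀ {n} .{{_ : NonZero n}} → Fin n × Fin n → Fin n × Fin n → Fin n × Fin n
(a₁ , a₂) +² (b₁ , b₂) = (a₁ +ₙ b₁ , a₂ +ₙ b₂)

pairs : ∀ {X : Set} → List X → List (X × X)
pairs xs = cartesianProduct xs xs

r₁ : ∀ {q} .{{_ : NonZero q}} → Subset q → Fin q → ℕ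
r₁ {q} A x =
  length (filter (λ { (a₁ , a₂) → (a₁ ∈? A) ×-dec ((a₂ ∈? A) ×-dec ((a₁ +ₙ a₂) ≟ x)) })
                 (pairs (allFin q)))

IsSidon₁ : ∀ {q} .{{_ : NonZero q}} → ℕ → Subset q → Set
IsSidon₁ {q} g A = ∀ (x : Fin q) → r₁ A x ≤ g

-- Subsets of ℤ_p² = ℤ_p × ℤ_p : Subset (p * p) is awkward, so we use
-- a characteristic vector indexed by pairs: Fin p → Subset p
-- (A i is the fibre {j : (i , j) ∈ A}).

Subset² : ℕ → Set
Subset² p = Fin p → Subset p

_∈²_ : ∀ {p} → Fin p × Fin p → Subset² p → Set
(i , j) ∈² A = j ∈ A i

_∈²?_ : ∀ {p} (x : Fin p × Fin p) (A : Subset² p) → Dec (x ∈² A)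
(i , j) ∈²? A = j ∈? A i

allFin² : ∀ p → List (Fin p × Fin p)
allFin² p = cartesianProduct (allFin p) (allFin p)

size² : ∀ {p} → Subset² p → ℕ
size² {p} A = length (filter (λ x → x ∈²? A) (allFin² p))

r₂ : ∀ {p} .{{_ : NonZero p}} → Subset² p → Fin p × Fin p → ℕ
r₂ {p} A x =
  length (filter (λ { (a₁ , a₂) → (a₁ ∈²? A) ×-dec ((a₂ ∈²? A) ×-dec (≟² (a₁ +² a₂) x)) })
                 (pairs (allFin² p)))
  where
  ≟² : (u v : Fin p × Fin p) → Dec (u ≡ v)
  ≟² = ≡-dec _≟_ _≟_

IsSidon₂ : ∀ {p} .{{_ : NonZero p}} → ℕ → Subset² p → Set
IsSidon₂ {p} g A = ∀ (x : Fin p × Fin p) → r₂ A x ≤ g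

module Submission where

-- Write u ∈ ℤ_q with three digits, u = a₁ + (t + a₂·s)·p, where the low digit a₁ and the high
-- digit a₂ are taken mod p and the middle digit t mod s, and let A′ consist of the u with
-- (a₁ , a₂) ∈ A.  Each α ∈ A has exactly s lifts, so |A′| = s·|A|.  If lifts of α, β ∈ A with
-- middle digits t and t′ add up to x in ℤ_q, schoolbook addition shows that t′ is determined
-- by t, and that α + β is the element target (t + c t) of ℤ_p², where c t ∈ {0, 1} is the carry
-- out of the middle digit; c is monotone in t, so t ↦ t + c t is injective from [0, s) into
-- [0, s].  Hence r_{A′}(x) ≤ ∑_{j ≤ s} r_A(target j) ≤ (s + 1)·g.

open import Defs
open import Data.Empty using (⊥-elim)
open import Data.Fin using (Fin; toℕ) renaming (zero to fzero; suc to fsuc)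
open import Data.Fin.Properties using (_≟_; fromℕ<-cong; toℕ-fromℕ<; toℕ-injective; toℕ<n)
open import Data.Fin.Subset using (Subset; ∣_∣)
open import Data.Fin.Subset.Properties using (_∈?_)
open import Data.List using (List; []; _∷_; length; filter; cartesianProduct; map; _++_; tabulate; allFin)
open import Data.Nat using (ℕ; zero; suc; _+_; _*_; _∸_; _≤_; _<_; z≤n; s≤s; s≤s⁻¹; NonZero; _<?_)
open import Data.Nat.DivMod
  using (_%_; _/_; _mod_; m≡m%n+[m/n]*n; m%n<n; m<n*o⇒m/o<n; [m+kn]%n≡m%n; [m+n]%n≡m%n;
         m<n⇒m%n≡m; m<n⇒m/n≡0; m*n/n≡m; m*n%n≡0; +-distrib-/)
open import Data.Nat.Primality using (Prime; prime⇒nonZero)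
open import Data.Nat.Properties hiding (_≟_)
open import Algebra.Properties.CommutativeSemigroup +-commutativeSemigroup
  using () renaming (interchange to +-interchange; xy∙z≈xz∙y to +-right-comm)
open import Data.Nat.Tactic.RingSolver using (solve-∀)
open import Data.Product using (Σ; _×_; _,_; proj₁; proj₂)
open import Data.Product.Properties using (≡-dec)
open import Data.Vec as Vec using (lookup)
open import Data.Vec.Properties using (lookup∘tabulate; lookup⇒[]=; []=⇒lookup)
open import Function using (_∘_; id)
open import Relation.Binary.PropositionalEquality
open import Relation.Nullary using (Dec; yes; no; does)
open import Relation.Nullary.Decidable using (_×-dec_)

𝟙 : ∀ {a} {P : Set a} → Dec P → ℕ
𝟙 (yes _) = 1
𝟙 (no _)  = 0

𝟙≤1 : ∀ {a} {P : Set a} (d : Dec P) → 𝟙 d ≤ 1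
𝟙≤1 (yes _) = s≤s z≤n
𝟙≤1 (no _)  = z≤n

𝟙-holds : ∀ {a} {P : Set a} → P → (d : Dec P) → 1 ≤ 𝟙 d
𝟙-holds _  (yes _) = s≤s z≤n
𝟙-holds pf (no ¬pf) = ⊥-elim (¬pf pf)

𝟙-× : ∀ {a b} {P : Set a} {Q : Set b} (d : Dec P) (e : Dec Q) → 𝟙 (d ×-dec e) ≡ 𝟙 d * 𝟙 e
𝟙-× (yes _) (yes _) = refl
𝟙-× (yes _) (no _)  = refl
𝟙-× (no _)  (yes _) = refl
𝟙-× (no _)  (no _)  = refl

sumBelow : ℕ → (ℕ → ℕ) → ℕ
sumBelow zero    f = 0
sumBelow (suc n) f = f 0 + sumBelow n (f ∘ suc)

syntax sumBelow n (λ i → f) = ∑[ i < n ] f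

sum-cong : ∀ n {f g : ℕ → ℕ} → (∀ i → i < n → f i ≡ g i) → ∑[ i < n ] f i ≡ ∑[ i < n ] g i
sum-cong zero    _   = refl
sum-cong (suc n) f≡g = cong₂ _+_ (f≡g 0 (s≤s z≤n)) (sum-cong n (λ i i<n → f≡g (suc i) (s≤s i<n)))

sum-mono : ∀ n {f g : ℕ → ℕ} → (∀ i → i < n → f i ≤ g i) → ∑[ i < n ] f i ≤ ∑[ i < n ] g i
sum-mono zero    _   = z≤n
sum-mono (suc n) f≤g = +-mono-≤ (f≤g 0 (s≤s z≤n)) (sum-mono n (λ i i<n → f≤g (suc i) (s≤s i<n)))

sum-zero : ∀ n → ∑[ i < n ] 0 ≡ 0
sum-zero zero    = refl
sum-zero (suc n) = sum-zero n

sum-const : ∀ n c → ∑[ i < n ] c ≡ n * c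
sum-const zero    c = refl
sum-const (suc n) c = cong (c +_) (sum-const n c)

sum-distrib-+ : ∀ n (f g : ℕ → ℕ) → ∑[ i < n ] (f i + g i) ≡ ∑[ i < n ] f i + ∑[ i < n ] g i
sum-distrib-+ zero    f g = refl
sum-distrib-+ (suc n) f g =
  trans (cong (f 0 + g 0 +_) (sum-distrib-+ n (f ∘ suc) (g ∘ suc)))
        (+-interchange (f 0) (g 0) _ _)

sum-*ˡ : ∀ n c (f : ℕ → ℕ) → ∑[ i < n ] (c * f i) ≡ c * ∑[ i < n ] f i
sum-*ˡ zero    c f = sym (*-zeroʳ c)
sum-*ˡ (suc n) c f = trans (cong (c * f 0 +_) (sum-*ˡ n c (f ∘ suc))) (sym (*-distribˡ-+ c (f 0) _))

sum-swap : ∀ n m (f : ℕ → ℕ → ℕ) → ∑[ i < n ] ∑[ j < m ] f i j ≡ ∑[ j < m ] ∑[ i < n ] f i j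
sum-swap zero    m f = sym (sum-zero m)
sum-swap (suc n) m f =
  trans (cong (sumBelow m (f 0) +_) (sum-swap n m (f ∘ suc)))
        (sym (sum-distrib-+ m (f 0) (λ j → ∑[ i < n ] f (suc i) j)))

sum-split-+ : ∀ a b (f : ℕ → ℕ) → ∑[ i < a + b ] f i ≡ ∑[ i < a ] f i + ∑[ i < b ] f (a + i)
sum-split-+ zero    b f = refl
sum-split-+ (suc a) b f = trans (cong (f 0 +_) (sum-split-+ a b (f ∘ suc))) (sym (+-assoc (f 0) _ _))

sum-split-* : ∀ m n (f : ℕ → ℕ) → ∑[ u < m * n ] f u ≡ ∑[ i < m ] ∑[ j < n ] f (j + i * n)
sum-split-* zero    n f = refl
sum-split-* (suc m) n f = begin
  ∑[ u < n + m * n ] f u                                  ≡⟨ sum-split-+ n (m * n) f ⟩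
  ∑[ j < n ] f j + ∑[ u < m * n ] f (n + u)               ≡⟨ cong₂ _+_ (sum-cong n (λ j _ → cong f (sym (+-identityʳ j))))
                                                                       (sum-split-* m n (f ∘ (n +_))) ⟩
  ∑[ j < n ] f (j + 0) + ∑[ i < m ] ∑[ j < n ] f (n + (j + i * n))
     ≡⟨ cong (sumBelow n (λ j → f (j + 0)) +_)
             (sum-cong m (λ i _ → sum-cong n (λ j _ → cong f (shift j i)))) ⟩
  ∑[ i < suc m ] ∑[ j < n ] f (j + i * n) ∎
  where
  open ≡-Reasoning
  shift : ∀ j i → n + (j + i * n) ≡ j + suc i * n
  shift j i = trans (sym (+-assoc n j (i * n))) (trans (cong (_+ i * n) (+-comm n j)) (+-assoc j n (i * n)))

sum-𝟙-unique : ∀ n {P : ℕ → Set} (P? : ∀ i → Dec (P i)) B →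
  (∀ i j → i < n → j < n → P i → P j → i ≡ j) → (∀ i → i < n → P i → 1 ≤ B) →
  ∑[ i < n ] 𝟙 (P? i) ≤ B
sum-𝟙-unique zero    P? B unique pos = z≤n
sum-𝟙-unique (suc n) P? B unique pos with P? 0
... | yes P0 = ≤-trans (≤-reflexive (cong suc (trans (sum-cong n no-other) (sum-zero n)))) (pos 0 (s≤s z≤n) P0)
  where
  no-other : ∀ i → i < n → 𝟙 (P? (suc i)) ≡ 0
  no-other i i<n with P? (suc i)
  ... | yes Pi with () ← unique 0 (suc i) (s≤s z≤n) (s≤s i<n) P0 Pi
  ... | no _ = refl
... | no _ = sum-𝟙-unique n (P? ∘ suc) B
               (λ i j i<n j<n Pi Pj → suc-injective (unique (suc i) (suc j) (s≤s i<n) (s≤s j<n) Pi Pj))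
               (λ i i<n → pos (suc i) (s≤s i<n))

-- If c is a monotone 0/1-valued function, then t ↦ t + c t maps [0, s) injectively
-- into [0, s], so the sum of F over the image is at most the sum over [0, s].
sum-shift : ∀ s (c F : ℕ → ℕ) → (∀ t → c t ≤ 1) → (∀ t → c t ≤ c (suc t)) →
  ∑[ t < s ] F (t + c t) ≤ ∑[ j < suc s ] F j
sum-shift zero    c F c≤1 mono = z≤n
sum-shift (suc s) c F c≤1 mono with c 0 in c0
... | zero = +-monoʳ-≤ (F 0) (sum-shift s (c ∘ suc) (F ∘ suc) (c≤1 ∘ suc) (mono ∘ suc))
... | suc zero = ≤-trans (≤-reflexive (cong (F 1 +_) (sum-cong s (λ t _ → cong F shifted)))) (m≤n+m _ (F 0))
  where
  all-one : ∀ t → c t ≡ 1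
  all-one zero    = c0
  all-one (suc t) = ≤-antisym (c≤1 (suc t)) (≤-trans (≤-reflexive (sym (all-one t))) (mono t))
  shifted : ∀ {t} → suc t + c (suc t) ≡ suc (suc t)
  shifted {t} = trans (cong (suc t +_) (all-one (suc t))) (+-comm (suc t) 1)
... | suc (suc _) with s≤s () ← ≤-trans (≤-reflexive (sym c0)) (c≤1 0)

sumL : ∀ {X : Set} → List X → (X → ℕ) → ℕ
sumL []       f = 0
sumL (x ∷ xs) f = f x + sumL xs f

sumL-cong : ∀ {X : Set} (xs : List X) {f g : X → ℕ} → (∀ x → f x ≡ g x) → sumL xs f ≡ sumL xs g
sumL-cong []       _   = refl
sumL-cong (x ∷ xs) f≡g = cong₂ _+_ (f≡g x) (sumL-cong xs f≡g)

sumL-mono : ∀ {X : Set} (xs : List X) {f g : X → ℕ} → (∀ x → f x ≤ g x) → sumL xs f ≤ sumL xs g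
sumL-mono []       _   = z≤n
sumL-mono (x ∷ xs) f≤g = +-mono-≤ (f≤g x) (sumL-mono xs f≤g)

sumL-*ʳ : ∀ {X : Set} (xs : List X) (f : X → ℕ) c → sumL xs (λ x → f x * c) ≡ sumL xs f * c
sumL-*ʳ []       f c = refl
sumL-*ʳ (x ∷ xs) f c = trans (cong (f x * c +_) (sumL-*ʳ xs f c)) (sym (*-distribʳ-+ c (f x) _))

sumL-*ˡ : ∀ {X : Set} (xs : List X) c (f : X → ℕ) → sumL xs (λ x → c * f x) ≡ c * sumL xs f
sumL-*ˡ []       c f = sym (*-zeroʳ c)
sumL-*ˡ (x ∷ xs) c f = trans (cong (c * f x +_) (sumL-*ˡ xs c f)) (sym (*-distribˡ-+ c (f x) _))

sumL-sum-swap : ∀ {X : Set} (xs : List X) (c : X → ℕ) n (f : X → ℕ → ℕ) →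
  sumL xs (λ x → c x * ∑[ j < n ] f x j) ≡ ∑[ j < n ] sumL xs (λ x → c x * f x j)
sumL-sum-swap []       c n f = sym (sum-zero n)
sumL-sum-swap (x ∷ xs) c n f = begin
  c x * ∑[ j < n ] f x j + sumL xs (λ y → c y * ∑[ j < n ] f y j)
    ≡⟨ cong₂ _+_ (sym (sum-*ˡ n (c x) (f x))) (sumL-sum-swap xs c n f) ⟩
  ∑[ j < n ] (c x * f x j) + ∑[ j < n ] sumL xs (λ y → c y * f y j)
    ≡⟨ sym (sum-distrib-+ n _ _) ⟩
  ∑[ j < n ] (c x * f x j + sumL xs (λ y → c y * f y j)) ∎
  where open ≡-Reasoning

length-filter-sumL : ∀ {X : Set} {P : X → Set} (P? : ∀ x → Dec (P x)) xs →
  length (filter P? xs) ≡ sumL xs (𝟙 ∘ P?)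
length-filter-sumL P? []       = refl
length-filter-sumL P? (x ∷ xs) with P? x
... | yes _ = cong suc (length-filter-sumL P? xs)
... | no _  = length-filter-sumL P? xs

sumL-++ : ∀ {X : Set} (xs ys : List X) f → sumL (xs ++ ys) f ≡ sumL xs f + sumL ys f
sumL-++ []       ys f = refl
sumL-++ (x ∷ xs) ys f = trans (cong (f x +_) (sumL-++ xs ys f)) (sym (+-assoc (f x) _ _))

sumL-map : ∀ {X Y : Set} (h : X → Y) xs f → sumL (map h xs) f ≡ sumL xs (f ∘ h)
sumL-map h []       f = refl
sumL-map h (x ∷ xs) f = cong (f (h x) +_) (sumL-map h xs f)

sumL-cartesian : ∀ {X Y : Set} (xs : List X) (ys : List Y) f →
  sumL (cartesianProduct xs ys) f ≡ sumL xs (λ x → sumL ys (λ y → f (x , y)))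
sumL-cartesian []       ys f = refl
sumL-cartesian (x ∷ xs) ys f =
  trans (sumL-++ (map (x ,_) ys) _ f) (cong₂ _+_ (sumL-map (x ,_) ys f) (sumL-cartesian xs ys f))

sumL-tabulate : ∀ {X : Set} n (h : Fin n → X) f (g : ℕ → ℕ) → (∀ i → f (h i) ≡ g (toℕ i)) →
  sumL (tabulate h) f ≡ ∑[ i < n ] g i
sumL-tabulate zero    h f g f∘h≡g = refl
sumL-tabulate (suc n) h f g f∘h≡g =
  cong₂ _+_ (f∘h≡g fzero) (sumL-tabulate n (h ∘ fsuc) f (g ∘ suc) (f∘h≡g ∘ fsuc))

sumL-allFin² : ∀ p (Φ : Fin p × Fin p → ℕ) (G : ℕ → ℕ → ℕ) →
  (∀ i j → Φ (i , j) ≡ G (toℕ i) (toℕ j)) → sumL (allFin² p) Φ ≡ ∑[ r₁ < p ] ∑[ r₂ < p ] G r₁ r₂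
sumL-allFin² p Φ G Φ≡G =
  trans (sumL-cartesian (allFin p) (allFin p) Φ)
        (sumL-tabulate p id _ _ (λ i → sumL-tabulate p id _ (G (toℕ i)) (Φ≡G i)))

subsetOf : ∀ {n} {P : Fin n → Set} → (∀ i → Dec (P i)) → Subset n
subsetOf P? = Vec.tabulate (does ∘ P?)

𝟙-∈ : ∀ {n a} {P : Set a} (S : Subset n) i (d : Dec P) → lookup S i ≡ does d → 𝟙 (i ∈? S) ≡ 𝟙 d
𝟙-∈ S i (yes _) Sᵢ≡true with i ∈? S
... | yes _   = refl
... | no i∉S = ⊥-elim (i∉S (lookup⇒[]= i S Sᵢ≡true))
𝟙-∈ S i (no _) Sᵢ≡false with i ∈? S
... | no _    = refl
... | yes i∈S with () ← trans (sym ([]=⇒lookup i∈S)) Sᵢ≡false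

∈-subsetOf : ∀ {n} {P : Fin n → Set} (P? : ∀ i → Dec (P i)) i → 𝟙 (i ∈? subsetOf P?) ≡ 𝟙 (P? i)
∈-subsetOf P? i = 𝟙-∈ (subsetOf P?) i (P? i) (lookup∘tabulate (does ∘ P?) i)

count-tabulate : ∀ n {P : Fin n → Set} (P? : ∀ i → Dec (P i)) (g : ℕ → ℕ) →
  (∀ i → 𝟙 (P? i) ≡ g (toℕ i)) → ∣ subsetOf P? ∣ ≡ ∑[ u < n ] g u
count-tabulate zero    P? g P?≡g = refl
count-tabulate (suc n) P? g P?≡g with P? fzero | P?≡g fzero
... | yes _ | 1≡g0 =
  trans (cong suc (count-tabulate n (P? ∘ fsuc) (g ∘ suc) (P?≡g ∘ fsuc))) (cong (_+ ∑[ u < n ] g (suc u)) 1≡g0)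
... | no _  | 0≡g0 =
  trans (count-tabulate n (P? ∘ fsuc) (g ∘ suc) (P?≡g ∘ fsuc)) (cong (_+ ∑[ u < n ] g (suc u)) 0≡g0)

%-radix : ∀ r k n .{{_ : NonZero n}} → r < n → (r + k * n) % n ≡ r
%-radix r k n r<n = trans ([m+kn]%n≡m%n r k n) (m<n⇒m%n≡m r<n)

/-radix : ∀ r k n .{{_ : NonZero n}} → r < n → (r + k * n) / n ≡ k
/-radix r k n r<n = trans (+-distrib-/ r (k * n) no-overflow) (cong₂ _+_ (m<n⇒m/n≡0 r<n) (m*n/n≡m k n))
  where
  no-overflow : r % n + (k * n) % n < n
  no-overflow = subst (_< n) (sym (trans (cong₂ _+_ (m<n⇒m%n≡m r<n) (m*n%n≡0 k n)) (+-identityʳ r))) r<n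

radix-< : ∀ x y n m → x < n → y < m → x + y * n < m * n
radix-< x y n m x<n y<m = ≤-trans (+-monoˡ-< (y * n) x<n) (*-monoˡ-≤ n y<m)

mod-cong : ∀ m k n .{{_ : NonZero n}} → m % n ≡ k % n → m mod n ≡ k mod n
mod-cong m k n eq = fromℕ<-cong (m % n) (k % n) eq _ _

mod-toℕ : ∀ {n} .{{_ : NonZero n}} m (i : Fin n) → m % n ≡ toℕ i → m mod n ≡ i
mod-toℕ m i eq = toℕ-injective (trans (toℕ-fromℕ< _) eq)

carry≤1 : ∀ a b n .{{_ : NonZero n}} → a ≤ n → b < n → (a + b) / n ≤ 1
carry≤1 a b n a≤n b<n =
  s≤s⁻¹ (m<n*o⇒m/o<n (≤-trans (+-mono-≤-< a≤n b<n) (≤-reflexive (cong (n +_) (sym (+-identityʳ n))))))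

carry-determined : ∀ d t t′ y c s → t′ < s → c ≤ 1 → d + t + t′ ≡ y + c * s → c ≡ 𝟙 (y <? d + t)
carry-determined d t t′ y zero s t′<s _ eq with y <? d + t
... | no _  = refl
... | yes y<d+t = ⊥-elim (<⇒≱ y<d+t (≤-trans (m≤m+n (d + t) t′) (≤-reflexive (trans eq (+-identityʳ y)))))
carry-determined d t t′ y (suc zero) s t′<s _ eq with y <? d + t
... | yes _ = refl
... | no y≮d+t =
  ⊥-elim (<⇒≱ (+-mono-≤-< (≮⇒≥ y≮d+t) t′<s) (≤-reflexive (sym (trans eq (cong (y +_) (+-identityʳ s))))))
carry-determined d t t′ y (suc (suc _)) s t′<s (s≤s ()) eq

-- For an incoming carry d ≤ 1, the carry c = [y < d + t] satisfies c = [y < t + c]: the carry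
-- can be read off from the shifted index t + c alone.
carry-stable : ∀ y d t → d ≤ 1 → 𝟙 (y <? t + 𝟙 (y <? d + t)) ≡ 𝟙 (y <? d + t)
carry-stable y d t d≤1 with y <? d + t
... | yes y<d+t with y <? t + 1
...   | yes _ = refl
...   | no y≮t+1 = ⊥-elim (y≮t+1 (≤-trans y<d+t (≤-trans (+-monoˡ-≤ t d≤1) (≤-reflexive (+-comm 1 t)))))
carry-stable y d t d≤1 | no y≮d+t with y <? t + 0
...   | no _ = refl
...   | yes y<t+0 = ⊥-elim (y≮d+t (≤-trans y<t+0 (≤-trans (≤-reflexive (+-identityʳ t)) (m≤n+m t d))))

-- An incoming carry c on a digit that is reduced mod n is, on the original summands,
-- a subtraction of c mod n.
borrow : ∀ n .{{_ : NonZero n}} a b c e k → c ≤ 1 → a + b + c ≡ e + k * n →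
         (a + b) % n ≡ (e + (n ∸ c)) % n
borrow n a b zero e k _ eq = begin
  (a + b) % n         ≡⟨ cong (_% n) (trans (sym (+-identityʳ (a + b))) eq) ⟩
  (e + k * n) % n     ≡⟨ [m+kn]%n≡m%n e k n ⟩
  e % n               ≡⟨ sym ([m+n]%n≡m%n e n) ⟩
  (e + n) % n         ∎
  where open ≡-Reasoning
borrow (suc n) a b (suc zero) e k _ eq = begin
  (a + b) % suc n                  ≡⟨ sym ([m+kn]%n≡m%n (a + b) 1 (suc n)) ⟩
  (a + b + 1 * suc n) % suc n      ≡⟨ cong (_% suc n) (trans (add-one a b n) (cong (_+ n) eq)) ⟩
  (e + k * suc n + n) % suc n      ≡⟨ cong (_% suc n) (+-right-comm e (k * suc n) n) ⟩
  (e + n + k * suc n) % suc n      ≡⟨ [m+kn]%n≡m%n (e + n) k (suc n) ⟩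
  (e + n) % suc n                  ∎
  where
  open ≡-Reasoning
  add-one : ∀ a b n → a + b + 1 * suc n ≡ a + b + 1 + n
  add-one = solve-∀
borrow n a b (suc (suc _)) e k (s≤s ()) eq

module MixedRadix (p s : ℕ) .{{_ : NonZero p}} .{{_ : NonZero s}} where

  q : ℕ
  q = p * p * s

  instance
    q≢0 : NonZero q
    q≢0 = m*n≢0 (p * p) s {{m*n≢0 p p}}

  join : ℕ → ℕ → ℕ → ℕ
  join r₁ rₘ r₂ = r₁ + (rₘ + r₂ * s) * p

  low : ℕ → ℕ
  low u = u % p

  mid : ℕ → ℕ
  mid u = (u / p) % s

  high : ℕ → ℕ
  high u = (u / p) / s

  join-< : ∀ {r₁ rₘ r₂} → r₁ < p → rₘ < s → r₂ < p → join r₁ rₘ r₂ < q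
  join-< {r₁} {rₘ} {r₂} r₁<p rₘ<s r₂<p =
    ≤-trans (radix-< r₁ (rₘ + r₂ * s) p (p * s) r₁<p (radix-< rₘ r₂ s p rₘ<s r₂<p))
            (≤-reflexive (reorder p s))
    where
    reorder : ∀ p s → p * s * p ≡ p * p * s
    reorder = solve-∀

  low-join : ∀ {r₁} rₘ r₂ → r₁ < p → low (join r₁ rₘ r₂) ≡ r₁
  low-join {r₁} rₘ r₂ r₁<p = %-radix r₁ (rₘ + r₂ * s) p r₁<p

  mid-join : ∀ {r₁ rₘ} r₂ → r₁ < p → rₘ < s → mid (join r₁ rₘ r₂) ≡ rₘ
  mid-join {r₁} {rₘ} r₂ r₁<p rₘ<s =
    trans (cong (_% s) (/-radix r₁ (rₘ + r₂ * s) p r₁<p)) (%-radix rₘ r₂ s rₘ<s)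

  high-join : ∀ {r₁ rₘ} r₂ → r₁ < p → rₘ < s → high (join r₁ rₘ r₂) ≡ r₂
  high-join {r₁} {rₘ} r₂ r₁<p rₘ<s =
    trans (cong (_/ s) (/-radix r₁ (rₘ + r₂ * s) p r₁<p)) (/-radix rₘ r₂ s rₘ<s)

  sum-join : ∀ (f : ℕ → ℕ) → ∑[ u < q ] f u ≡ ∑[ r₁ < p ] ∑[ r₂ < p ] ∑[ t < s ] f (join r₁ t r₂)
  sum-join f = begin
    ∑[ u < q ] f u                                       ≡⟨ cong (λ n → sumBelow n f) (reorder p s) ⟩
    ∑[ u < p * s * p ] f u                               ≡⟨ sum-split-* (p * s) p f ⟩
    ∑[ y < p * s ] ∑[ r₁ < p ] f (r₁ + y * p)            ≡⟨ sum-split-* p s _ ⟩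
    ∑[ r₂ < p ] ∑[ t < s ] ∑[ r₁ < p ] f (join r₁ t r₂)  ≡⟨ sum-cong p (λ r₂ _ → sum-swap s p _) ⟩
    ∑[ r₂ < p ] ∑[ r₁ < p ] ∑[ t < s ] f (join r₁ t r₂)  ≡⟨ sum-swap p p _ ⟩
    ∑[ r₁ < p ] ∑[ r₂ < p ] ∑[ t < s ] f (join r₁ t r₂)  ∎
    where
    open ≡-Reasoning
    reorder : ∀ p s → p * p * s ≡ p * s * p
    reorder = solve-∀

  module Addition (r₁ rₘ r₂ r₁′ rₘ′ r₂′ : ℕ) where

    carry₁ : ℕ
    carry₁ = (r₁ + r₁′) / p

    carryₘ : ℕ
    carryₘ = (carry₁ + rₘ + rₘ′) / s

    carry₂ : ℕ
    carry₂ = (r₂ + r₂′ + carryₘ) / p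

    digit₁ : ℕ
    digit₁ = (r₁ + r₁′) % p

    digitₘ : ℕ
    digitₘ = (carry₁ + rₘ + rₘ′) % s

    digit₂ : ℕ
    digit₂ = (r₂ + r₂′ + carryₘ) % p

    join-+ : join r₁ rₘ r₂ + join r₁′ rₘ′ r₂′ ≡ join digit₁ digitₘ digit₂ + carry₂ * q
    join-+ = begin
      join r₁ rₘ r₂ + join r₁′ rₘ′ r₂′
        ≡⟨ regroup₁ r₁ rₘ r₂ r₁′ rₘ′ r₂′ p s ⟩
      r₁ + r₁′ + (rₘ + rₘ′ + (r₂ + r₂′) * s) * p
        ≡⟨ cong (_+ (rₘ + rₘ′ + (r₂ + r₂′) * s) * p) (m≡m%n+[m/n]*n (r₁ + r₁′) p) ⟩
      digit₁ + carry₁ * p + (rₘ + rₘ′ + (r₂ + r₂′) * s) * p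
        ≡⟨ regroup₂ digit₁ carry₁ rₘ rₘ′ (r₂ + r₂′) p s ⟩
      digit₁ + (carry₁ + rₘ + rₘ′ + (r₂ + r₂′) * s) * p
        ≡⟨ cong (λ m → digit₁ + (m + (r₂ + r₂′) * s) * p) (m≡m%n+[m/n]*n (carry₁ + rₘ + rₘ′) s) ⟩
      digit₁ + (digitₘ + carryₘ * s + (r₂ + r₂′) * s) * p
        ≡⟨ regroup₃ digit₁ digitₘ carryₘ (r₂ + r₂′) p s ⟩
      digit₁ + (digitₘ + (r₂ + r₂′ + carryₘ) * s) * p
        ≡⟨ cong (λ h → digit₁ + (digitₘ + h * s) * p) (m≡m%n+[m/n]*n (r₂ + r₂′ + carryₘ) p) ⟩
      digit₁ + (digitₘ + (digit₂ + carry₂ * p) * s) * p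
        ≡⟨ regroup₄ digit₁ digitₘ digit₂ carry₂ p s ⟩
      join digit₁ digitₘ digit₂ + carry₂ * q ∎
      where
      open ≡-Reasoning
      regroup₁ : ∀ a b c a′ b′ c′ p s →
        a + (b + c * s) * p + (a′ + (b′ + c′ * s) * p) ≡ a + a′ + (b + b′ + (c + c′) * s) * p
      regroup₁ = solve-∀
      regroup₂ : ∀ x d b b′ c p s → x + d * p + (b + b′ + c * s) * p ≡ x + (d + b + b′ + c * s) * p
      regroup₂ = solve-∀
      regroup₃ : ∀ x y k c p s → x + (y + k * s + c * s) * p ≡ x + (y + (c + k) * s) * p
      regroup₃ = solve-∀
      regroup₄ : ∀ x y z k p s → x + (y + (z + k * p) * s) * p ≡ x + (y + z * s) * p + k * (p * p * s)
      regroup₄ = solve-∀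

    join-+-mod : (join r₁ rₘ r₂ + join r₁′ rₘ′ r₂′) % q ≡ join digit₁ digitₘ digit₂
    join-+-mod = trans (cong (_% q) join-+)
      (%-radix _ carry₂ q
        (join-< (m%n<n (r₁ + r₁′) p) (m%n<n (carry₁ + rₘ + rₘ′) s) (m%n<n (r₂ + r₂′ + carryₘ) p)))

module Construction (p s : ℕ) .{{_ : NonZero p}} .{{_ : NonZero s}} (A : Subset² p) where

  open MixedRadix p s

  ℤp² : List (Fin p × Fin p)
  ℤp² = allFin² p

  _≟²_ : (α β : Fin p × Fin p) → Dec (α ≡ β)
  _≟²_ = ≡-dec _≟_ _≟_

  embed : Fin p × Fin p → ℕ → ℕ
  embed (a₁ , a₂) t = join (toℕ a₁) t (toℕ a₂)

  π : ℕ → Fin p × Fin p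
  π u = (u mod p , high u mod p)

  π-embed : ∀ α {t} → t < s → π (embed α t) ≡ α
  π-embed (a₁ , a₂) {t} t<s = cong₂ _,_
    (mod-toℕ _ a₁ (low-join t (toℕ a₂) (toℕ<n a₁)))
    (mod-toℕ _ a₂ (trans (cong (_% p) (high-join (toℕ a₂) (toℕ<n a₁) t<s)) (m<n⇒m%n≡m (toℕ<n a₂))))

  π-∈? : ∀ (u : Fin q) → Dec (π (toℕ u) ∈² A)
  π-∈? u = π (toℕ u) ∈²? A

  A′ : Subset q
  A′ = subsetOf π-∈?

  inA : Fin p × Fin p → ℕ
  inA α = 𝟙 (α ∈²? A)

  inA′ : ℕ → ℕ
  inA′ u = 𝟙 (π u ∈²? A)

  sum-over-A′ : ∀ (F : ℕ → ℕ) →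
    ∑[ u < q ] (inA′ u * F u) ≡ sumL ℤp² (λ α → inA α * ∑[ t < s ] F (embed α t))
  sum-over-A′ F = begin
    ∑[ u < q ] (inA′ u * F u)
      ≡⟨ sum-join _ ⟩
    ∑[ r₁ < p ] ∑[ r₂ < p ] ∑[ t < s ] (inA′ (join r₁ t r₂) * F (join r₁ t r₂))
      ≡⟨ sym (sumL-allFin² p _ _ (λ _ _ → refl)) ⟩
    sumL ℤp² (λ α → ∑[ t < s ] (inA′ (embed α t) * F (embed α t)))
      ≡⟨ sumL-cong ℤp² (λ α → trans (sum-cong s (λ t t<s → cong (λ β → 𝟙 (β ∈²? A) * F (embed α t))
                                                                  (π-embed α t<s)))
                                    (sum-*ˡ s (inA α) _)) ⟩
    sumL ℤp² (λ α → inA α * ∑[ t < s ] F (embed α t)) ∎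
    where open ≡-Reasoning

  -- Each element of A has s lifts.
  ∣A′∣ : ∣ A′ ∣ ≡ size² A * s
  ∣A′∣ = begin
    ∣ A′ ∣                                   ≡⟨ count-tabulate q _ inA′ (λ _ → refl) ⟩
    ∑[ u < q ] inA′ u                        ≡⟨ sum-cong q (λ u _ → sym (*-identityʳ (inA′ u))) ⟩
    ∑[ u < q ] (inA′ u * 1)                  ≡⟨ sum-over-A′ (λ _ → 1) ⟩
    sumL ℤp² (λ α → inA α * ∑[ t < s ] 1)    ≡⟨ sumL-cong ℤp² (λ α → cong (inA α *_) s-lifts) ⟩
    sumL ℤp² (λ α → inA α * s)               ≡⟨ sumL-*ʳ ℤp² inA s ⟩
    sumL ℤp² inA * s                         ≡⟨ cong (_* s) (sym (length-filter-sumL _ ℤp²)) ⟩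
    size² A * s                              ∎
    where
    open ≡-Reasoning
    s-lifts : ∑[ t < s ] 1 ≡ s
    s-lifts = trans (sum-const s 1) (*-identityʳ s)

  r₂-as-sum : ∀ z → r₂ A z ≡ sumL ℤp² (λ α → inA α * sumL ℤp² (λ β → inA β * 𝟙 ((α +² β) ≟² z)))
  r₂-as-sum z =
    trans (length-filter-sumL _ (pairs ℤp²))
    (trans (sumL-cartesian ℤp² ℤp² _)
           (sumL-cong ℤp² (λ α → trans (sumL-cong ℤp² (entry α)) (sumL-*ˡ ℤp² (inA α) _))))
    where
    entry : ∀ α β → 𝟙 ((α ∈²? A) ×-dec ((β ∈²? A) ×-dec ((α +² β) ≟² z))) ≡ inA α * (inA β * 𝟙 ((α +² β) ≟² z))
    entry α β = trans (𝟙-× (α ∈²? A) _) (cong (inA α *_) (𝟙-× (β ∈²? A) ((α +² β) ≟² z)))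

  module Representations (x : Fin q) where

    X : ℕ
    X = toℕ x

    hits : ℕ → ℕ → ℕ
    hits u v = 𝟙 ((u + v) mod q ≟ x)

    r₁-as-sum : r₁ A′ x ≡ ∑[ u < q ] (inA′ u * ∑[ v < q ] (inA′ v * hits u v))
    r₁-as-sum =
      trans (length-filter-sumL _ (pairs (allFin q)))
      (trans (sumL-cartesian (allFin q) (allFin q) _)
      (trans (sumL-tabulate q id _ (λ u → ∑[ v < q ] (inA′ u * (inA′ v * hits u v)))
                (λ i → sumL-tabulate q id _ (λ v → inA′ (toℕ i) * (inA′ v * hits (toℕ i) v)) (entry i)))
             (sum-cong q (λ u _ → sum-*ˡ q (inA′ u) _))))
      where
      entry : ∀ i j → 𝟙 ((i ∈? A′) ×-dec ((j ∈? A′) ×-dec ((i +ₙ j) ≟ x)))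
                      ≡ inA′ (toℕ i) * (inA′ (toℕ j) * hits (toℕ i) (toℕ j))
      entry i j = trans (𝟙-× (i ∈? A′) _)
        (cong₂ _*_ (∈-subsetOf π-∈? i)
                   (trans (𝟙-× (j ∈? A′) ((i +ₙ j) ≟ x)) (cong (_* hits (toℕ i) (toℕ j)) (∈-subsetOf π-∈? j))))

    lowCarry : Fin p × Fin p → Fin p × Fin p → ℕ
    lowCarry (a₁ , _) (b₁ , _) = (toℕ a₁ + toℕ b₁) / p

    -- The carry out of the middle digits when the lifts of α and β with middle digits t and t′ sum to x.
    midCarry : Fin p × Fin p → Fin p × Fin p → ℕ → ℕ
    midCarry α β t = 𝟙 (mid X <? lowCarry α β + t)

    midCarry-mono : ∀ α β t → midCarry α β t ≤ midCarry α β (suc t)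
    midCarry-mono α β t with mid X <? lowCarry α β + t | mid X <? lowCarry α β + suc t
    ... | yes _ | yes _ = ≤-refl
    ... | no _  | _     = z≤n
    ... | yes x<c+t | no x≮c+1+t =
      ⊥-elim (x≮c+1+t (≤-trans x<c+t (≤-trans (n≤1+n _) (≤-reflexive (sym (+-suc _ t))))))

    -- The possible values of α + β: target j is (low x, high x) for j ≤ mid x and
    -- (low x, high x − 1) for j > mid x; lifts of α and β with middle digit t for α can only sum
    -- to x if α + β = target (t + midCarry α β t).
    target : ℕ → Fin p × Fin p
    target j = (X mod p , (high X + (p ∸ 𝟙 (mid X <? j))) mod p)

    lifts-summing-to-x : ∀ α β {t t′} → t < s → t′ < s → (embed α t + embed β t′) mod q ≡ x →
      (lowCarry α β + t + t′ ≡ mid X + s * midCarry α β t) × ((α +² β) ≡ target (t + midCarry α β t))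
    lifts-summing-to-x (a₁ , a₂) (b₁ , b₂) {t} {t′} t<s t′<s sum≡x = middle-digits , outer-digits
      where
      open Addition (toℕ a₁) t (toℕ a₂) (toℕ b₁) t′ (toℕ b₂)

      X-digits : X ≡ join digit₁ digitₘ digit₂
      X-digits = trans (cong toℕ (sym sum≡x)) (trans (toℕ-fromℕ< _) join-+-mod)

      digit₁<p : digit₁ < p
      digit₁<p = m%n<n (toℕ a₁ + toℕ b₁) p

      digitₘ<s : digitₘ < s
      digitₘ<s = m%n<n (carry₁ + t + t′) s

      carry₁≤1 : carry₁ ≤ 1
      carry₁≤1 = carry≤1 (toℕ a₁) (toℕ b₁) p (<⇒≤ (toℕ<n a₁)) (toℕ<n b₁)

      carryₘ≤1 : carryₘ ≤ 1
      carryₘ≤1 = carry≤1 (carry₁ + t) t′ s (≤-trans (+-monoˡ-≤ t carry₁≤1) t<s) t′<s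

      mid-X : mid X ≡ digitₘ
      mid-X = trans (cong mid X-digits) (mid-join digit₂ digit₁<p digitₘ<s)

      carryₘ-is-midCarry : carryₘ ≡ midCarry (a₁ , a₂) (b₁ , b₂) t
      carryₘ-is-midCarry =
        trans (carry-determined carry₁ t t′ digitₘ carryₘ s t′<s carryₘ≤1
                                (m≡m%n+[m/n]*n (carry₁ + t + t′) s))
              (cong (λ y → 𝟙 (y <? carry₁ + t)) (sym mid-X))

      middle-digits : carry₁ + t + t′ ≡ mid X + s * midCarry (a₁ , a₂) (b₁ , b₂) t
      middle-digits = trans (m≡m%n+[m/n]*n (carry₁ + t + t′) s)
        (cong₂ _+_ (sym mid-X) (trans (cong (_* s) carryₘ-is-midCarry) (*-comm _ s)))

      low-digits : (toℕ a₁ + toℕ b₁) mod p ≡ X mod p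
      low-digits = mod-cong _ X p (sym (trans (cong low X-digits) (low-join digitₘ digit₂ digit₁<p)))

      high-digits : (toℕ a₂ + toℕ b₂) mod p
                    ≡ (high X + (p ∸ 𝟙 (mid X <? t + midCarry (a₁ , a₂) (b₁ , b₂) t))) mod p
      high-digits = mod-cong _ _ p (begin
        (toℕ a₂ + toℕ b₂) % p
          ≡⟨ borrow p (toℕ a₂) (toℕ b₂) carryₘ digit₂ carry₂ carryₘ≤1
                    (m≡m%n+[m/n]*n (toℕ a₂ + toℕ b₂ + carryₘ) p) ⟩
        (digit₂ + (p ∸ carryₘ)) % p
          ≡⟨ cong₂ (λ h c → (h + (p ∸ c)) % p)
                   (sym (trans (cong high X-digits) (high-join digit₂ digit₁<p digitₘ<s)))
                   (trans carryₘ-is-midCarry (sym (carry-stable (mid X) carry₁ t carry₁≤1))) ⟩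
        (high X + (p ∸ 𝟙 (mid X <? t + midCarry (a₁ , a₂) (b₁ , b₂) t))) % p ∎)
        where open ≡-Reasoning

      outer-digits : ((a₁ , a₂) +² (b₁ , b₂)) ≡ target (t + midCarry (a₁ , a₂) (b₁ , b₂) t)
      outer-digits = cong₂ _,_ low-digits high-digits

    one-partner : ∀ α β {t} → t < s →
      ∑[ t′ < s ] hits (embed α t) (embed β t′) ≤ 𝟙 ((α +² β) ≟² target (t + midCarry α β t))
    one-partner α β {t} t<s = sum-𝟙-unique s (λ t′ → (embed α t + embed β t′) mod q ≟ x) _
      (λ i j i<s j<s hitᵢ hitⱼ → +-cancelˡ-≡ (lowCarry α β + t) i j
         (trans (proj₁ (lifts-summing-to-x α β t<s i<s hitᵢ))
                (sym (proj₁ (lifts-summing-to-x α β t<s j<s hitⱼ)))))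
      (λ i i<s hitᵢ → 𝟙-holds (proj₂ (lifts-summing-to-x α β t<s i<s hitᵢ)) _)

    pair-bound : ∀ α β →
      ∑[ t < s ] ∑[ t′ < s ] hits (embed α t) (embed β t′) ≤ ∑[ j < suc s ] 𝟙 ((α +² β) ≟² target j)
    pair-bound α β = ≤-trans (sum-mono s (λ t t<s → one-partner α β t<s))
      (sum-shift s (midCarry α β) (λ j → 𝟙 ((α +² β) ≟² target j))
                 (λ t → 𝟙≤1 (mid X <? lowCarry α β + t)) (midCarry-mono α β))

    r₁-in-digits : r₁ A′ x ≡
      sumL ℤp² (λ α → inA α * sumL ℤp² (λ β → inA β * ∑[ t < s ] ∑[ t′ < s ] hits (embed α t) (embed β t′)))
    r₁-in-digits = begin
      r₁ A′ x
        ≡⟨ r₁-as-sum ⟩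
      ∑[ u < q ] (inA′ u * ∑[ v < q ] (inA′ v * hits u v))
        ≡⟨ sum-over-A′ _ ⟩
      sumL ℤp² (λ α → inA α * ∑[ t < s ] ∑[ v < q ] (inA′ v * hits (embed α t) v))
        ≡⟨ sumL-cong ℤp² (λ α → cong (inA α *_) (sum-cong s (λ t _ → sum-over-A′ (hits (embed α t))))) ⟩
      sumL ℤp² (λ α → inA α * ∑[ t < s ] sumL ℤp² (λ β → inA β * ∑[ t′ < s ] hits (embed α t) (embed β t′)))
        ≡⟨ sumL-cong ℤp² (λ α → cong (inA α *_) (sym (sumL-sum-swap ℤp² inA s _))) ⟩
      sumL ℤp² (λ α → inA α * sumL ℤp² (λ β → inA β * ∑[ t < s ] ∑[ t′ < s ] hits (embed α t) (embed β t′))) ∎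
      where open ≡-Reasoning

    r₁-bound : ∀ {g} → IsSidon₂ g A → r₁ A′ x ≤ g * (s + 1)
    r₁-bound {g} A-sidon = begin
      r₁ A′ x
        ≡⟨ r₁-in-digits ⟩
      sumL ℤp² (λ α → inA α * sumL ℤp² (λ β → inA β * ∑[ t < s ] ∑[ t′ < s ] hits (embed α t) (embed β t′)))
        ≤⟨ sumL-mono ℤp² (λ α → *-monoʳ-≤ (inA α) (sumL-mono ℤp² (λ β → *-monoʳ-≤ (inA β) (pair-bound α β)))) ⟩
      sumL ℤp² (λ α → inA α * sumL ℤp² (λ β → inA β * ∑[ j < suc s ] 𝟙 ((α +² β) ≟² target j)))
        ≡⟨ sumL-cong ℤp² (λ α → cong (inA α *_)
                                      (sumL-sum-swap ℤp² inA (suc s) (λ β j → 𝟙 ((α +² β) ≟² target j)))) ⟩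
      sumL ℤp² (λ α → inA α * ∑[ j < suc s ] sumL ℤp² (λ β → inA β * 𝟙 ((α +² β) ≟² target j)))
        ≡⟨ sumL-sum-swap ℤp² inA (suc s) (λ α j → sumL ℤp² (λ β → inA β * 𝟙 ((α +² β) ≟² target j))) ⟩
      ∑[ j < suc s ] sumL ℤp² (λ α → inA α * sumL ℤp² (λ β → inA β * 𝟙 ((α +² β) ≟² target j)))
        ≡⟨ sum-cong (suc s) (λ j _ → sym (r₂-as-sum (target j))) ⟩
      ∑[ j < suc s ] r₂ A (target j)
        ≤⟨ sum-mono (suc s) (λ j _ → A-sidon (target j)) ⟩
      ∑[ j < suc s ] g
        ≡⟨ sum-const (suc s) g ⟩
      suc s * g
        ≡⟨ trans (*-comm (suc s) g) (cong (g *_) (+-comm 1 s)) ⟩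
      g * (s + 1) ∎
      where open ≤-Reasoning

  A′-sidon : ∀ {g} → IsSidon₂ g A → IsSidon₁ (g * (s + 1)) A′
  A′-sidon A-sidon x = Representations.r₁-bound x A-sidon

-- The construction only needs p ≠ 0, which primality provides.
theorem5 : (p : ℕ) (pp : Prime p) (g m s : ℕ) .{{s≢0 : NonZero s}} (A : Subset² p) →
           IsSidon₂ {{prime⇒nonZero pp}} g A → size² A ≡ m →
           Σ (Subset (p * p * s)) λ A′ →
             IsSidon₁ {{m*n≢0 (p * p) s {{m*n≢0 p p {{prime⇒nonZero pp}} {{prime⇒nonZero pp}}}}}} (g * (s + 1)) A′
             × ∣ A′ ∣ ≡ m * s
theorem5 p pp g .(size² A) s A A-sidon refl = A′ , A′-sidon A-sidon , ∣A′∣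
  where open Construction p s {{prime⇒nonZero pp}} A
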